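{- For every integer $n\ge 4$, \[ \operatorname{tw}(F_3(K_n)) \le \left\lceil\frac{n}{3}\right\rceil\binom{n-\lceil n/3\rceil}{2}+\frac12\left\lceil\frac{n}{3}\right\rceil\left(\left\lceil\frac{n}{3}\right\rceil+1\right)-2. \]
   Context: For a graph $G$, the $3$-token graph $F_3(G)$ has as vertices the $3$-element subsets of $V(G)$, two being adjacent when their symmetric difference is an edge of $G$; $F_3(K_n)$ is the Johnson graph $J(n,3)$. $\operatorname{tw}$ denotes treewidth (minimum over tree decompositions of the maximum bag size minus one). -}

module Defs where

open import Level using (0ℓ)
open import Data.Nat using (ℕ; zero; suc; _+_; _*_; _∸_; _≤_; _<_; _/_)
open import Data.Nat.Combinatorics using (_C_)
open import Data.Fin using (Fin; toℕ; _≟_)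
open import Data.Fin.Subset using (Subset; ∣_∣; _∈_; _∉_)
open import Data.List using (List; length; [])
import Data.List.Membership.Propositional as LM
open import Data.Product using (Σ; ∃; ∃-syntax; _×_; _,_)
open import Data.Sum using (_⊎_)
open import Relation.Binary.PropositionalEquality using (_≡_)
open import Relation.Nullary using (¬_)

-- A graph on a vertex type V, given by its adjacency relation.  (The graphs
-- used below, K_n and F_3(G), are irreflexive and symmetric by construction.)
record Graph (V : Set) : Set₁ where
  constructor graph
  field
    Adj   : V → V → Set
open Graph public

K : (n : ℕ) → Graph (Fin n)
K n = graph (λ x y → ¬ x ≡ y)

record Triple (n : ℕ) : Set where
  constructor triple
  field
    set  : Subset n
    card : ∣ set ∣ ≡ 3
open Triple public

SymDiffIs : ∀ {n} → Subset n → Subset n → Fin n → Fin n → Set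
SymDiffIs A B x y =
  ∀ z → (((z ∈ A × z ∉ B) ⊎ (z ∈ B × z ∉ A)) → (z ≡ x ⊎ z ≡ y))
      × ((z ≡ x ⊎ z ≡ y) → ((z ∈ A × z ∉ B) ⊎ (z ∈ B × z ∉ A)))

TokAdj : ∀ {n} → Graph (Fin n) → Triple n → Triple n → Set
TokAdj G A B = ∃[ x ] ∃[ y ] (Adj G x y × SymDiffIs (set A) (set B) x y)

F3 : ∀ {n} → Graph (Fin n) → Graph (Triple n)
F3 G = graph (TokAdj G)

-- Trees with node set Fin (suc t): node 0 is the root, every node i > 0 has
-- a parent p(i) with p(i) < i.  Every finite tree is isomorphic to one of
-- these (order nodes by BFS from a root).
record Tree : Set where
  field
    size   : ℕ                                  -- number of nodes = suc size
    parent : (i : Fin (suc size)) → 0 < toℕ i → Fin (suc size)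
    parent< : ∀ i (p : 0 < toℕ i) → toℕ (parent i p) < toℕ i
open Tree public

Node : Tree → Set
Node T = Fin (suc (size T))

TreeAdj : (T : Tree) → Node T → Node T → Set
TreeAdj T i j = (∃[ p ] parent T i p ≡ j) ⊎ (∃[ p ] parent T j p ≡ i)

data WalkIn {A : Set} (R : A → A → Set) (P : A → Set) : A → A → Set where
  here : ∀ {a} → P a → WalkIn R P a a
  step : ∀ {a b c} → P a → R a b → WalkIn R P b c → WalkIn R P a c

record TreeDecomposition {V : Set} (G : Graph V) : Set₁ where
  field
    tree : Tree
    bag  : Node tree → V → Set
    vertexCover : ∀ v → ∃[ i ] bag i v
    edgeCover   : ∀ u v → Adj G u v → ∃[ i ] (bag i u × bag i v)
    connected   : ∀ v i j → bag i v → bag j v →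
                  WalkIn (TreeAdj tree) (λ k → bag k v) i j
open TreeDecomposition public

AtMost : {V : Set} → ℕ → (V → Set) → Set
AtMost {V} m P = ∃[ xs ] (length xs ≤ m × (∀ v → P v → v LM.∈ xs))

-- tw(G) ≤ k : G has a tree decomposition all of whose bags have size ≤ k + 1.
TwLe : {V : Set} → Graph V → ℕ → Set₁
TwLe G k = ∃[ D ] (∀ i → AtMost (suc k) (bag {G = G} D i))

ceil3 : ℕ → ℕ
ceil3 n = (n + 2) / 3

-- The bound  c * C(n - c, 2) + c (c + 1) / 2 - 2  with c = ⌈ n / 3 ⌉.
-- (c (c + 1) is even, so the division is exact.)
twBound : ℕ → ℕ
twBound n = ceil3 n * ((n ∸ ceil3 n) C 2) + (ceil3 n * (ceil3 n + 1)) / 2 ∸ 2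

module Submission where

open import Defs
open import Data.Bool using (true; false)
open import Data.Empty using (⊥; ⊥-elim)
open import Data.Fin using (Fin; toℕ; fromℕ<; inject₁) renaming (zero to fzero; suc to fsuc)
open import Data.Fin.Properties using (toℕ-injective; toℕ-fromℕ<; fromℕ<-toℕ; toℕ-inject₁; toℕ<n)
open import Data.Fin.Subset using (Subset; ∣_∣; ⁅_⁆; _∪_; _⊆_; _-_) renaming (_∈_ to _∈ₛ_; _∉_ to _∉ₛ_)
open import Data.Fin.Subset.Properties using (_∈?_; x∈p∪q⁻; x∈p∪q⁺; x∈⁅x⁆; x∈⁅y⁆⇒x≡y; ⊆-antisym; p⊆q⇒∣p∣≤∣q∣; x∈p∧x≢y⇒x∈p-y; x∈p⇒∣p-x∣<∣p∣)
open import Data.List using (List; []; _∷_; _++_; map; length; cartesianProduct; mapMaybe)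
open import Data.List.Properties using (length-++; length-map; length-mapMaybe)
open import Data.List.Membership.Propositional using (_∈_)
open import Data.List.Membership.Propositional.Properties using (∈-++⁺ˡ; ∈-++⁺ʳ; ∈-cartesianProduct⁺; ∈-map⁺; ∈-map⁻)
open import Data.List.Relation.Unary.Any using (here; there)
open import Data.List.Relation.Unary.Linked as Linked using (Linked; [-]) renaming (_∷_ to _∷ₗ_)
open import Data.List.Relation.Unary.Linked.Properties using (map⁺)
open import Data.Maybe using (Maybe; just; nothing; _>>=_)
open import Data.Nat using (ℕ; zero; suc; _+_; _*_; _∸_; _≤_; _<_; z≤n; s≤s; _⊔_; _≟_; _≤?_; _<?_; _/_; _%_; NonZero)
open import Data.Nat.Combinatorics using (_C_; nC1≡n; nCk+nC[k+1]≡[n+1]C[k+1])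
open import Data.Nat.DivMod using (m≡m%n+[m/n]*n; m%n<n; m*n/n≡m; m/n*n≤m)
open import Data.Nat.Properties
open import Data.Nat.Tactic.RingSolver using (solve-∀)
open import Data.Product using (∃-syntax; _×_; _,_; proj₁; proj₂)
open import Data.Sum using (_⊎_; inj₁; inj₂; swap; map₁)
open import Data.Vec.Base as Vec using ([]; _∷_)
open import Function using (_∘_; id)
open import Relation.Binary.Definitions using (tri<; tri≈; tri>)
open import Relation.Binary.PropositionalEquality
open import Relation.Nullary using (yes; no; ¬_)

-- Rank the pairs p < q of {0, …, n − 1} lexicographically, rank(p, q) = p·n + q, and attach to
-- the triple a < b < d the interval [rank(a, b), rank(b, d)].  It contains the rank of every pair
-- inside the triple, and triples adjacent in F₃(G) ⊆ J(n, 3) share a pair, so the triples whose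
-- interval contains t, for t = 0, …, n², form a path decomposition.
-- Write t = x·n + y, z = max(y, x + 1) and n = x + 1 + g + r with z = x + g.  A triple alive at t
-- has a < x < b, or a < x = b and z ≤ d, or a = x < b < d ≤ z, or a = x < b ≤ z < d, so at most
-- x·C(g + r, 2) + x·(r + 1) + C(g, 2) + g·r triples are alive.  With c = ⌈n/3⌉ this is less than
-- peak(n, c), where peak(n, j) = j·C(n − j, 2) + C(j + 1, 2): for x < c it is less than
-- peak(n, x + 1) and peak(n, ·) increases up to c; for x ≥ c it is small since g + r < n − c ≤ 2c.

-- Path decompositions from intervals

module _ {A : Set} {R : A → A → Set} {P : A → Set} where

  walk-snoc : ∀ {a b c} → WalkIn R P a b → R b c → P c → WalkIn R P a c
  walk-snoc (here pa)     r pc = step pa r (here pc)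
  walk-snoc (step pa r w) s pc = step pa r (walk-snoc w s pc)

  walk-reverse : (∀ {a b} → R a b → R b a) → ∀ {a b} → WalkIn R P a b → WalkIn R P b a
  walk-reverse R-sym (here pa)     = here pa
  walk-reverse R-sym (step pa r w) = walk-snoc (walk-reverse R-sym w) (R-sym r) pa

predecessor : ∀ {N} (i : Fin (suc N)) → 0 < toℕ i → Fin (suc N)
predecessor (fsuc j) _ = inject₁ j

predecessor< : ∀ {N} (i : Fin (suc N)) (i>0 : 0 < toℕ i) → toℕ (predecessor i i>0) < toℕ i
predecessor< (fsuc j) _ = s≤s (≤-reflexive (toℕ-inject₁ j))

pathTree : ℕ → Tree
pathTree N = record { size = N ; parent = predecessor ; parent< = predecessor< }

TreeAdj-sym : ∀ T {i j} → TreeAdj T i j → TreeAdj T j i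
TreeAdj-sym T = swap

module _ {N : ℕ} {Q : Fin (suc N) → Set} where

  walk-down : ∀ d (i j : Fin (suc N)) → toℕ j ≡ d + toℕ i →
              (∀ k → toℕ i ≤ toℕ k → toℕ k ≤ toℕ j → Q k) →
              WalkIn (TreeAdj (pathTree N)) Q j i
  walk-down zero i j j≡i Q-between with toℕ-injective j≡i
  ... | refl = here (Q-between i ≤-refl ≤-refl)
  walk-down (suc d) i (fsuc j) j≡d+i Q-between =
    step (Q-between (fsuc j) i≤sj ≤-refl) (inj₁ (s≤s z≤n , refl))
         (walk-down d i (inject₁ j) j≡ (λ k i≤k k≤j → Q-between k i≤k (≤-trans k≤j j≤sj)))
    where
    j≡ : toℕ (inject₁ j) ≡ d + toℕ i
    j≡ = trans (toℕ-inject₁ j) (suc-injective j≡d+i)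
    j≤sj : toℕ (inject₁ j) ≤ suc (toℕ j)
    j≤sj = ≤-trans (≤-reflexive (toℕ-inject₁ j)) (n≤1+n (toℕ j))
    i≤sj : toℕ i ≤ suc (toℕ j)
    i≤sj = ≤-trans (m≤n+m (toℕ i) (suc d)) (≤-reflexive (sym j≡d+i))

  walk-between : (∀ i j k → toℕ i ≤ toℕ k → toℕ k ≤ toℕ j → Q i → Q j → Q k) →
                 ∀ i j → Q i → Q j → WalkIn (TreeAdj (pathTree N)) Q i j
  walk-between convex i j Qi Qj with ≤-total (toℕ i) (toℕ j)
  ... | inj₁ i≤j = walk-reverse (TreeAdj-sym (pathTree N))
                     (walk-down (toℕ j ∸ toℕ i) i j (sym (m∸n+n≡m i≤j))
                       (λ k i≤k k≤j → convex i j k i≤k k≤j Qi Qj))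
  ... | inj₂ j≤i = walk-down (toℕ i ∸ toℕ j) j i (sym (m∸n+n≡m j≤i))
                     (λ k j≤k k≤i → convex j i k j≤k k≤i Qj Qi)

module _ {V : Set} (G : Graph V) (N : ℕ) (lo hi : V → ℕ)
         (lo≤hi : ∀ v → lo v ≤ hi v) (hi≤N : ∀ v → hi v ≤ N)
         (edge-overlap : ∀ u v → Adj G u v → lo u ≤ hi v × lo v ≤ hi u) where

  Alive : ℕ → V → Set
  Alive t v = lo v ≤ t × t ≤ hi v

  private
    node : ∀ t → t ≤ N → Fin (suc N)
    node t t≤N = fromℕ< (s≤s t≤N)

    alive-node : ∀ v t (t≤N : t ≤ N) → Alive t v → Alive (toℕ (node t t≤N)) v
    alive-node v t t≤N rewrite toℕ-fromℕ< (s≤s t≤N) = id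

    lo≤N : ∀ v → lo v ≤ N
    lo≤N v = ≤-trans (lo≤hi v) (hi≤N v)

  intervalDecomposition : TreeDecomposition G
  intervalDecomposition = record
    { tree        = pathTree N
    ; bag         = λ i → Alive (toℕ i)
    ; vertexCover = λ v → node (lo v) (lo≤N v) , alive-node v (lo v) (lo≤N v) (≤-refl , lo≤hi v)
    ; edgeCover   = shared-node
    ; connected   = λ v → walk-between (λ _ _ _ i≤k k≤j (lo≤i , _) (_ , j≤hi) →
                                          ≤-trans lo≤i i≤k , ≤-trans k≤j j≤hi)
    }
    where
    shared-node : ∀ u v → Adj G u v → ∃[ i ] (Alive (toℕ i) u × Alive (toℕ i) v)
    shared-node u v uv =
      node t t≤N , alive-node u t t≤N (m≤m⊔n (lo u) (lo v) , ⊔-lub (lo≤hi u) (proj₂ (edge-overlap u v uv)))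
                 , alive-node v t t≤N (m≤n⊔m (lo u) (lo v) , ⊔-lub (proj₁ (edge-overlap u v uv)) (lo≤hi v))
      where
      t : ℕ
      t = lo u ⊔ lo v
      t≤N : t ≤ N
      t≤N = ⊔-lub (lo≤N u) (lo≤N v)

  TwLe-intervals : ∀ k → (∀ t → t ≤ N → AtMost (suc k) (Alive t)) → TwLe G k
  TwLe-intervals k small = intervalDecomposition , λ i → small (toℕ i) (≤-pred (toℕ<n i))

[1+n]C2≡n+nC2 : ∀ n → suc n C 2 ≡ n + n C 2
[1+n]C2≡n+nC2 n = trans (sym (nCk+nC[k+1]≡[n+1]C[k+1] n 1)) (cong (_+ n C 2) (nC1≡n n))

2*[1+n]C2≡[1+n]*n : ∀ n → 2 * (suc n C 2) ≡ suc n * n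
2*[1+n]C2≡[1+n]*n zero    = refl
2*[1+n]C2≡[1+n]*n (suc n) = begin
  2 * (suc (suc n) C 2)         ≡⟨ cong (2 *_) ([1+n]C2≡n+nC2 (suc n)) ⟩
  2 * (suc n + suc n C 2)       ≡⟨ *-distribˡ-+ 2 (suc n) _ ⟩
  2 * suc n + 2 * (suc n C 2)   ≡⟨ cong (2 * suc n +_) (2*[1+n]C2≡[1+n]*n n) ⟩
  2 * suc n + suc n * n         ≡⟨ identity n ⟩
  suc (suc n) * suc n           ∎
  where
  open ≡-Reasoning
  identity : ∀ n → 2 * suc n + suc n * n ≡ suc (suc n) * suc n
  identity = solve-∀

[m+n]C2≡mC2+nC2+m*n : ∀ m n → (m + n) C 2 ≡ m C 2 + n C 2 + m * n
[m+n]C2≡mC2+nC2+m*n zero    n = sym (+-identityʳ (n C 2))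
[m+n]C2≡mC2+nC2+m*n (suc m) n = begin
  suc (m + n) C 2                     ≡⟨ [1+n]C2≡n+nC2 (m + n) ⟩
  m + n + (m + n) C 2                 ≡⟨ cong (m + n +_) ([m+n]C2≡mC2+nC2+m*n m n) ⟩
  m + n + (m C 2 + n C 2 + m * n)     ≡⟨ identity m n (m C 2) (n C 2) ⟩
  (m + m C 2) + n C 2 + suc m * n     ≡⟨ cong (λ c → c + n C 2 + suc m * n) ([1+n]C2≡n+nC2 m) ⟨
  suc m C 2 + n C 2 + suc m * n       ∎
  where
  open ≡-Reasoning
  identity : ∀ m n a b → m + n + (a + b + m * n) ≡ (m + a) + b + suc m * n
  identity = solve-∀

-- (n − m)(n − m − 1) ≥ 0, written without subtraction.
m*n≤nC2+[1+m]C2 : ∀ m n → m * n ≤ n C 2 + suc m C 2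
m*n≤nC2+[1+m]C2 zero    n       = z≤n
m*n≤nC2+[1+m]C2 (suc m) zero    = ≤-trans (≤-reflexive (*-zeroʳ m)) z≤n
m*n≤nC2+[1+m]C2 (suc m) (suc n) = begin
  suc m * suc n                             ≡⟨ expand m n ⟩
  suc m + n + m * n                         ≤⟨ +-monoʳ-≤ (suc m + n) (m*n≤nC2+[1+m]C2 m n) ⟩
  suc m + n + (n C 2 + suc m C 2)           ≡⟨ regroup (suc m) n (n C 2) (suc m C 2) ⟩
  (n + n C 2) + (suc m + suc m C 2)         ≡⟨ sym (cong₂ _+_ ([1+n]C2≡n+nC2 n) ([1+n]C2≡n+nC2 (suc m))) ⟩
  suc n C 2 + suc (suc m) C 2               ∎
  where
  open ≤-Reasoning
  expand : ∀ m n → suc m * suc n ≡ suc m + n + m * n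
  expand = solve-∀
  regroup : ∀ a n b c → a + n + (b + c) ≡ (n + b) + (a + c)
  regroup = solve-∀

[1+n]C2≤m*n : ∀ m n → suc n ≤ 2 * m → suc n C 2 ≤ m * n
[1+n]C2≤m*n m n n<2m = *-cancelˡ-≤ 2 (begin
  2 * (suc n C 2)   ≡⟨ 2*[1+n]C2≡[1+n]*n n ⟩
  suc n * n         ≤⟨ *-monoˡ-≤ n n<2m ⟩
  2 * m * n         ≡⟨ *-assoc 2 m n ⟩
  2 * (m * n)       ∎)
  where open ≤-Reasoning

m*n≤nC2+m : ∀ m n → 2 * m ≤ n → m * n ≤ n C 2 + m
m*n≤nC2+m zero    n       _   = z≤n
m*n≤nC2+m (suc m) zero    ()
m*n≤nC2+m m       (suc n) 2m≤n = begin
  m * suc n              ≡⟨ *-suc m n ⟩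
  m + m * n              ≤⟨ +-monoʳ-≤ m (*-cancelˡ-≤ 2 (begin
                              2 * (m * n)     ≡⟨ *-assoc 2 m n ⟨
                              2 * m * n       ≤⟨ *-monoˡ-≤ n 2m≤n ⟩
                              suc n * n       ≡⟨ 2*[1+n]C2≡[1+n]*n n ⟨
                              2 * (suc n C 2) ∎)) ⟩
  m + suc n C 2          ≡⟨ +-comm m _ ⟩
  suc n C 2 + m          ∎
  where open ≤-Reasoning

module _ {V : Set} where

  AtMost-weaken : ∀ {k l} {P : V → Set} → k ≤ l → AtMost k P → AtMost l P
  AtMost-weaken k≤l (xs , len , mem) = xs , ≤-trans len k≤l , mem

  AtMost-⊆ : ∀ {k} {P Q : V → Set} → (∀ v → P v → Q v) → AtMost k Q → AtMost k P
  AtMost-⊆ P⊆Q (xs , len , mem) = xs , len , λ v → mem v ∘ P⊆Q v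

  AtMost-∅ : ∀ {P : V → Set} → (∀ v → ¬ P v) → AtMost 0 P
  AtMost-∅ ¬P = [] , z≤n , λ v → ⊥-elim ∘ ¬P v

  AtMost-≡ : ∀ (x : V) → AtMost 1 (λ v → v ≡ x)
  AtMost-≡ x = x ∷ [] , ≤-refl , λ { _ refl → here refl }

  AtMost-⊎ : ∀ {k l} {P Q : V → Set} → AtMost k P → AtMost l Q → AtMost (k + l) (λ v → P v ⊎ Q v)
  AtMost-⊎ (xs , |xs| , P⊆xs) (ys , |ys| , Q⊆ys) =
    xs ++ ys , ≤-trans (≤-reflexive (length-++ xs)) (+-mono-≤ |xs| |ys|) ,
    λ { v (inj₁ p) → ∈-++⁺ˡ (P⊆xs v p) ; v (inj₂ q) → ∈-++⁺ʳ xs (Q⊆ys v q) }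

length-cartesianProduct : ∀ {A B : Set} (xs : List A) (ys : List B) →
                          length (cartesianProduct xs ys) ≡ length xs * length ys
length-cartesianProduct []       ys = refl
length-cartesianProduct (x ∷ xs) ys = begin
  length (map (x ,_) ys ++ cartesianProduct xs ys)  ≡⟨ length-++ (map (x ,_) ys) ⟩
  length (map (x ,_) ys) + length (cartesianProduct xs ys)
    ≡⟨ cong₂ _+_ (length-map (x ,_) ys) (length-cartesianProduct xs ys) ⟩
  length ys + length xs * length ys                            ∎
  where open ≡-Reasoning

AtMost-× : ∀ {A B : Set} {k l} {P : A → Set} {Q : B → Set} →
           AtMost k P → AtMost l Q → AtMost (k * l) (λ ab → P (proj₁ ab) × Q (proj₂ ab))
AtMost-× (xs , |xs| , P⊆xs) (ys , |ys| , Q⊆ys) =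
  cartesianProduct xs ys , ≤-trans (≤-reflexive (length-cartesianProduct xs ys)) (*-mono-≤ |xs| |ys|) ,
  λ { (a , b) (p , q) → ∈-cartesianProduct⁺ (P⊆xs a p) (Q⊆ys b q) }

Range : ℕ → ℕ → ℕ → Set
Range lo l v = lo ≤ v × v < lo + l

Pairs : ℕ → ℕ → ℕ × ℕ → Set
Pairs lo l (p , q) = lo ≤ p × p < q × q < lo + l

<-last : ∀ {v} lo l → v < lo + suc l → v < lo + l ⊎ v ≡ lo + l
<-last {v} lo l v<lo+1+l = m≤n⇒m<n∨m≡n (≤-pred (subst (v <_) (+-suc lo l) v<lo+1+l))

AtMost-range : ∀ lo l → AtMost l (Range lo l)
AtMost-range lo zero    = AtMost-∅ λ v (lo≤v , v<lo+0) → <⇒≱ (subst (v <_) (+-identityʳ lo) v<lo+0) lo≤v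
AtMost-range lo (suc l) =
  AtMost-weaken (≤-reflexive (+-comm l 1))
    (AtMost-⊆ split (AtMost-⊎ (AtMost-range lo l) (AtMost-≡ (lo + l))))
  where
  split : ∀ v → Range lo (suc l) v → Range lo l v ⊎ v ≡ lo + l
  split v (lo≤v , v<) = map₁ (lo≤v ,_) (<-last lo l v<)

AtMost-pairs : ∀ lo l → AtMost (l C 2) (Pairs lo l)
AtMost-pairs lo zero    = AtMost-∅ λ { (p , q) (lo≤p , p<q , q<lo+0) →
                            <⇒≱ (subst (q <_) (+-identityʳ lo) q<lo+0) (≤-trans lo≤p (<⇒≤ p<q)) }
AtMost-pairs lo (suc l) =
  AtMost-weaken (≤-reflexive (trans (cong (l C 2 +_) (*-identityʳ l)) (trans (+-comm (l C 2) l) (sym ([1+n]C2≡n+nC2 l)))))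
    (AtMost-⊆ split (AtMost-⊎ (AtMost-pairs lo l) (AtMost-× (AtMost-range lo l) (AtMost-≡ (lo + l)))))
  where
  split : ∀ pq → Pairs lo (suc l) pq → Pairs lo l pq ⊎ (Range lo l (proj₁ pq) × proj₂ pq ≡ lo + l)
  split (p , q) (lo≤p , p<q , q<) with <-last lo l q<
  ... | inj₁ q<lo+l = inj₁ (lo≤p , p<q , q<lo+l)
  ... | inj₂ refl   = inj₂ ((lo≤p , p<q) , refl)

AtMost-≡× : ∀ {A B : Set} {k} {Q : B → Set} (x : A) → AtMost k Q → AtMost k (λ ab → proj₁ ab ≡ x × Q (proj₂ ab))
AtMost-≡× {k = k} x Q≤k = AtMost-weaken (≤-reflexive (+-identityʳ k)) (AtMost-× (AtMost-≡ x) Q≤k)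

∈-mapMaybe⁺ : ∀ {A B : Set} (g : A → Maybe B) {xs x y} → x ∈ xs → g x ≡ just y → y ∈ mapMaybe g xs
∈-mapMaybe⁺ g {x ∷ xs} (here refl) gx≡y rewrite gx≡y = here refl
∈-mapMaybe⁺ g {x ∷ xs} (there y∈) gx≡y with g x
... | just _  = there (∈-mapMaybe⁺ g y∈ gx≡y)
... | nothing = ∈-mapMaybe⁺ g y∈ gx≡y

AtMost-retract : ∀ {V W : Set} {k} {P : V → Set} {Q : W → Set} (f : V → W) (g : W → Maybe V) →
                 (∀ v → P v → Q (f v) × g (f v) ≡ just v) → AtMost k Q → AtMost k P
AtMost-retract f g P⇒Q (ws , |ws| , Q⊆ws) =
  mapMaybe g ws , ≤-trans (length-mapMaybe g ws) |ws| ,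
  λ v Pv → ∈-mapMaybe⁺ g (Q⊆ws (f v) (proj₁ (P⇒Q v Pv))) (proj₂ (P⇒Q v Pv))

-- The live triples at a time

rank : ℕ → ℕ → ℕ → ℕ
rank n p q = p * n + q

rank-< : ∀ {n p p′} q q′ → p < p′ → q < n → rank n p q < rank n p′ q′
rank-< {n} {p} {p′} q q′ p<p′ q<n = begin-strict
  p * n + q      <⟨ +-monoʳ-< (p * n) q<n ⟩
  p * n + n      ≡⟨ +-comm (p * n) n ⟩
  suc p * n      ≤⟨ *-monoˡ-≤ n p<p′ ⟩
  p′ * n         ≤⟨ m≤m+n (p′ * n) q′ ⟩
  p′ * n + q′    ∎
  where open ≤-Reasoning

rank-≤⁻ : ∀ {n p q x y} → q < n → y < n → rank n p q ≤ rank n x y → p < x ⊎ (p ≡ x × q ≤ y)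
rank-≤⁻ {n} {p} {q} {x} {y} q<n y<n pq≤xy with <-cmp p x
... | tri< p<x _ _ = inj₁ p<x
... | tri≈ _ refl _ = inj₂ (refl , +-cancelˡ-≤ (p * n) q y pq≤xy)
... | tri> _ _ x<p = ⊥-elim (<⇒≱ (rank-< y q x<p y<n) pq≤xy)

Cover : ℕ → ℕ → ℕ → ℕ × ℕ × ℕ → Set
Cover x z n (a , b , d) =
    (a < x × x < b × b < d × d < n)
  ⊎ (a < x × b ≡ x × z ≤ d × d < n)
  ⊎ (a ≡ x × x < b × b < d × d ≤ z)
  ⊎ (a ≡ x × x < b × b ≤ z × z < d × d < n)

coverSize : ℕ → ℕ → ℕ → ℕ
coverSize x g r = x * ((g + r) C 2) + x * suc r + (g C 2 + g * r)

AtMost-cover : ∀ x g r → AtMost (coverSize x g r) (Cover x (x + g) (suc (x + g + r)))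
AtMost-cover x g r =
  AtMost-⊆ (λ _ → regroup)
    (AtMost-⊎ (AtMost-⊎ (AtMost-× (AtMost-range 0 x) (AtMost-pairs (suc x) (g + r)))
                        (AtMost-× (AtMost-range 0 x) (AtMost-≡× x (AtMost-range (x + g) (suc r)))))
              (AtMost-⊎ (AtMost-≡× x (AtMost-pairs (suc x) g))
                        (AtMost-≡× x (AtMost-× (AtMost-range (suc x) g) (AtMost-range (suc (x + g)) r)))))
  where
  d<n⇒ : ∀ {d} → d < suc (x + g + r) → d < suc x + (g + r)
  d<n⇒ {d} = subst (d <_) (cong suc (+-assoc x g r))
  regroup : ∀ {a b d} → Cover x (x + g) (suc (x + g + r)) (a , b , d) →
              ((Range 0 x a × Pairs (suc x) (g + r) (b , d)) ⊎ (Range 0 x a × b ≡ x × Range (x + g) (suc r) d))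
            ⊎ ((a ≡ x × Pairs (suc x) g (b , d)) ⊎ (a ≡ x × Range (suc x) g b × Range (suc (x + g)) r d))
  regroup (inj₁ (a<x , x<b , b<d , d<n))                     = inj₁ (inj₁ ((z≤n , a<x) , x<b , b<d , d<n⇒ d<n))
  regroup {d = d} (inj₂ (inj₁ (a<x , b≡x , z≤d , d<n)))      = inj₁ (inj₂ ((z≤n , a<x) , b≡x , z≤d , subst (d <_) (sym (+-suc (x + g) r)) d<n))
  regroup (inj₂ (inj₂ (inj₁ (a≡x , x<b , b<d , d≤z))))       = inj₂ (inj₁ (a≡x , x<b , b<d , s≤s d≤z))
  regroup (inj₂ (inj₂ (inj₂ (a≡x , x<b , b≤z , z<d , d<n)))) = inj₂ (inj₂ (a≡x , (x<b , s≤s b≤z) , z<d , d<n))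

lex-between⇒Cover : ∀ {n x y a b d} → y < n → a < b → b < d → d < n →
                    rank n a b ≤ rank n x y → rank n x y ≤ rank n b d → Cover x (y ⊔ suc x) n (a , b , d)
lex-between⇒Cover {n} {x} {y} {a} {b} {d} y<n a<b b<d d<n ab≤xy xy≤bd
  with rank-≤⁻ (<-trans b<d d<n) y<n ab≤xy | rank-≤⁻ y<n d<n xy≤bd
... | inj₁ a<x          | inj₁ x<b          = inj₁ (a<x , x<b , b<d , d<n)
... | inj₁ a<x          | inj₂ (refl , y≤d) = inj₂ (inj₁ (a<x , refl , ⊔-lub y≤d b<d , d<n))
... | inj₂ (refl , _)   | inj₂ (refl , _)   = ⊥-elim (<-irrefl refl a<b)
... | inj₂ (refl , b≤y) | inj₁ _ with d ≤? y ⊔ suc x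
...   | yes d≤z = inj₂ (inj₂ (inj₁ (refl , a<b , b<d , d≤z)))
...   | no  d≰z = inj₂ (inj₂ (inj₂ (refl , a<b , ≤-trans b≤y (m≤m⊔n y (suc x)) , ≰⇒> d≰z , d<n)))

LexAlive : ℕ → ℕ → ℕ × ℕ × ℕ → Set
LexAlive n t (a , b , d) = (a < b × b < d × d < n) × rank n a b ≤ t × t ≤ rank n b d

module _ (n : ℕ) .{{_ : NonZero n}} (t : ℕ) where

  private
    x y z : ℕ
    x = t / n
    y = t % n
    z = y ⊔ suc x

    y<n : y < n
    y<n = m%n<n t n

    t≡xy : t ≡ rank n x y
    t≡xy = trans (m≡m%n+[m/n]*n t n) (+-comm y (x * n))

    alive⇒z<n : ∀ v → LexAlive n t v → z < n
    alive⇒z<n (a , b , d) ((a<b , b<d , d<n) , _ , t≤bd) =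
      ⊔-lub y<n (≤-<-trans (≤-<-trans (x≤b (rank-≤⁻ y<n d<n (subst (_≤ rank n b d) t≡xy t≤bd))) b<d) d<n)
      where
      x≤b : x < b ⊎ (x ≡ b × y ≤ d) → x ≤ b
      x≤b (inj₁ x<b)       = <⇒≤ x<b
      x≤b (inj₂ (x≡b , _)) = ≤-reflexive x≡b

  AtMost-lexAlive : ∀ {B} → (∀ x h r → suc (x + (suc h + r)) ≡ n → coverSize x (suc h) r ≤ B) →
                    AtMost B (LexAlive n t)
  AtMost-lexAlive {B} cover≤B with z <? n
  ... | no z≮n  = AtMost-weaken z≤n (AtMost-∅ λ v alive → z≮n (alive⇒z<n v alive))
  ... | yes z<n =
    AtMost-weaken (cover≤B x h r (trans (cong suc (sym (+-assoc x (suc h) r))) x+1+h+1+r≡n))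
      (AtMost-⊆ alive⇒cover
        (subst₂ (λ z n → AtMost (coverSize x (suc h) r) (Cover x z n)) x+1+h≡z x+1+h+1+r≡n
          (AtMost-cover x (suc h) r)))
    where
    h r : ℕ
    h = z ∸ suc x
    r = n ∸ suc z
    x+1+h≡z : x + suc h ≡ z
    x+1+h≡z = trans (+-suc x h) (m+[n∸m]≡n (m≤n⊔m y (suc x)))
    x+1+h+1+r≡n : suc (x + suc h + r) ≡ n
    x+1+h+1+r≡n = trans (cong (λ z → suc (z + r)) x+1+h≡z) (m+[n∸m]≡n z<n)
    alive⇒cover : ∀ v → LexAlive n t v → Cover x z n v
    alive⇒cover (a , b , d) ((a<b , b<d , d<n) , ab≤t , t≤bd) =
      lex-between⇒Cover y<n a<b b<d d<n (subst (rank n a b ≤_) t≡xy ab≤t) (subst (_≤ rank n b d) t≡xy t≤bd)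

-- Bounding the live triples

peak : ℕ → ℕ → ℕ
peak n j = j * ((n ∸ j) C 2) + suc j C 2

peak-step : ∀ j p → 2 * j ≤ p → peak (j + suc p) j ≤ peak (j + suc p) (suc j)
peak-step j p 2j≤p = begin
  j * ((j + suc p ∸ j) C 2) + suc j C 2
    ≡⟨ cong (λ q → j * (q C 2) + suc j C 2) (m+n∸m≡n j (suc p)) ⟩
  j * (suc p C 2) + suc j C 2
    ≡⟨ cong (λ q → j * q + suc j C 2) ([1+n]C2≡n+nC2 p) ⟩
  j * (p + p C 2) + suc j C 2
    ≡⟨ cong (_+ suc j C 2) (*-distribˡ-+ j p (p C 2)) ⟩
  j * p + j * (p C 2) + suc j C 2
    ≤⟨ +-monoˡ-≤ (suc j C 2) (+-monoˡ-≤ (j * (p C 2)) (≤-trans (m*n≤nC2+m j p 2j≤p) (+-monoʳ-≤ (p C 2) (n≤1+n j)))) ⟩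
  p C 2 + suc j + j * (p C 2) + suc j C 2
    ≡⟨ regroup (p C 2) j (j * (p C 2)) (suc j C 2) ⟩
  suc j * (p C 2) + (suc j + suc j C 2)
    ≡⟨ cong₂ (λ q r → suc j * (q C 2) + r) (m+n∸m≡n (suc j) p) ([1+n]C2≡n+nC2 (suc j)) ⟨
  suc j * ((suc j + p ∸ suc j) C 2) + suc (suc j) C 2
    ≡⟨ cong (λ q → suc j * ((q ∸ suc j) C 2) + suc (suc j) C 2) (+-suc j p) ⟨
  suc j * ((j + suc p ∸ suc j) C 2) + suc (suc j) C 2 ∎
  where
  open ≤-Reasoning
  regroup : ∀ a j b c → a + suc j + b + c ≡ a + b + (suc j + c)
  regroup = solve-∀

peak-mono : ∀ n j d → 3 * (j + d) ≤ n + 2 → peak n j ≤ peak n (j + d)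
peak-mono n j zero    _      = ≤-reflexive (cong (peak n) (sym (+-identityʳ j)))
peak-mono n j (suc d) 3k≤n+2 = begin
  peak n j              ≤⟨ peak-mono n j d (≤-trans (*-monoʳ-≤ 3 (+-monoʳ-≤ j (n≤1+n d))) 3k≤n+2) ⟩
  peak n (j + d)        ≤⟨ subst (λ n → peak n k ≤ peak n (suc k)) n≡k+1+p (peak-step k p 2k≤p) ⟩
  peak n (suc (j + d))  ≡⟨ cong (peak n) (+-suc j d) ⟨
  peak n (j + suc d)    ∎
  where
  open ≤-Reasoning
  k p : ℕ
  k = j + d
  p = n ∸ suc k
  room : suc k + 2 * k ≤ n
  room = +-cancelʳ-≤ 2 _ _ (subst (_≤ n + 2) (identity k) (subst (λ i → 3 * i ≤ n + 2) (+-suc j d) 3k≤n+2))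
    where
    identity : ∀ k → 3 * suc k ≡ suc k + 2 * k + 2
    identity = solve-∀
  n≡1+k+p : suc k + p ≡ n
  n≡1+k+p = m+[n∸m]≡n (≤-trans (m≤m+n (suc k) (2 * k)) room)
  n≡k+1+p : k + suc p ≡ n
  n≡k+1+p = trans (+-suc k p) n≡1+k+p
  2k≤p : 2 * k ≤ p
  2k≤p = +-cancelˡ-≤ (suc k) _ _ (subst (suc k + 2 * k ≤_) (sym n≡1+k+p) room)

-- The instance m = 1 + h, n = c of m*n≤nC2+[1+m]C2, i.e. (c − h − 1)(c − h − 2) ≥ 0.
[1+h]C2+[1+h]*r<c*h+[1+c]C2 : ∀ c h r → suc (suc h) + r ≤ 2 * c →
                              suc h C 2 + suc h * r < c * h + suc c C 2
[1+h]C2+[1+h]*r<c*h+[1+c]C2 c h r h+r+2≤2c = +-cancelʳ-≤ (c * suc h) _ _ (begin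
  suc (suc h C 2 + suc h * r) + c * suc h
    ≤⟨ +-monoʳ-≤ _ (subst (_≤ c C 2 + suc (suc h) C 2) (*-comm (suc h) c) (m*n≤nC2+[1+m]C2 (suc h) c)) ⟩
  suc (suc h C 2 + suc h * r) + (c C 2 + suc (suc h) C 2)
    ≤⟨ m≤m+n _ (h + s * suc h) ⟩
  suc (suc h C 2 + suc h * r) + (c C 2 + suc (suc h) C 2) + (h + s * suc h)
    ≡⟨ cong (λ q → suc (suc h C 2 + suc h * r) + (c C 2 + q) + (h + s * suc h)) ([1+n]C2≡n+nC2 (suc h)) ⟩
  suc (suc h C 2 + suc h * r) + (c C 2 + (suc h + suc h C 2)) + (h + s * suc h)
    ≡⟨ collect h r s (suc h C 2) (c C 2) ⟩
  2 * (suc h C 2) + suc h * (2 + r + s) + c C 2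
    ≡⟨ cong (λ q → q + suc h * (2 + r + s) + c C 2) (2*[1+n]C2≡[1+n]*n h) ⟩
  suc h * h + suc h * (2 + r + s) + c C 2
    ≡⟨ cong (λ q → q + c C 2) (sym (*-distribˡ-+ (suc h) h (2 + r + s))) ⟩
  suc h * (h + (2 + r + s)) + c C 2
    ≡⟨ cong (λ q → suc h * q + c C 2) (trans (shuffle h r s) h+r+s+2≡2c) ⟩
  suc h * (2 * c) + c C 2
    ≡⟨ spread c h (c C 2) ⟩
  c * h + (c + c C 2) + c * suc h
    ≡⟨ cong (λ q → c * h + q + c * suc h) ([1+n]C2≡n+nC2 c) ⟨
  c * h + suc c C 2 + c * suc h ∎)
  where
  open ≤-Reasoning
  s : ℕ
  s = 2 * c ∸ (suc (suc h) + r)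
  h+r+s+2≡2c : suc (suc h) + r + s ≡ 2 * c
  h+r+s+2≡2c = m+[n∸m]≡n h+r+2≤2c
  collect : ∀ h r s a b → suc (a + suc h * r) + (b + (suc h + a)) + (h + s * suc h) ≡ 2 * a + suc h * (2 + r + s) + b
  collect = solve-∀
  shuffle : ∀ h r s → h + (2 + r + s) ≡ suc (suc h) + r + s
  shuffle = solve-∀
  spread : ∀ c h b → suc h * (2 * c) + b ≡ c * h + (c + b) + c * suc h
  spread = solve-∀

coverSize<peak-below : ∀ x g r → coverSize x g r < suc x * ((g + r) C 2) + suc (suc x) C 2
coverSize<peak-below x g r = begin
  suc (x * P + x * suc r + (g C 2 + g * r))
    ≡⟨ cong (λ q → suc (x * P + q + (g C 2 + g * r))) (*-suc x r) ⟩
  suc (x * P + (x + x * r) + (g C 2 + g * r))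
    ≤⟨ s≤s (+-monoˡ-≤ (g C 2 + g * r) (+-monoʳ-≤ (x * P) (+-monoʳ-≤ x (m*n≤nC2+[1+m]C2 x r)))) ⟩
  suc (x * P + (x + (r C 2 + suc x C 2)) + (g C 2 + g * r))
    ≡⟨ regroup x g r P (r C 2) (suc x C 2) (g C 2) ⟩
  (g C 2 + r C 2 + g * r) + x * P + (suc x + suc x C 2)
    ≡⟨ cong₂ (λ p q → p + x * P + q) ([m+n]C2≡mC2+nC2+m*n g r) ([1+n]C2≡n+nC2 (suc x)) ⟨
  suc x * P + suc (suc x) C 2 ∎
  where
  open ≤-Reasoning
  P : ℕ
  P = (g + r) C 2
  regroup : ∀ x g r P a b c → suc (x * P + (x + (a + b)) + (c + g * r)) ≡ (c + a + g * r) + x * P + (suc x + b)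
  regroup = solve-∀

coverSize<peak-beyond : ∀ c x h r → suc (x + (suc h + r)) ≤ 2 * c →
                        coverSize (c + x) (suc h) r < c * (suc (x + (suc h + r)) C 2) + suc c C 2
coverSize<peak-beyond c x h r m≤2c = begin
  suc (coverSize (c + x) (suc h) r)
    ≡⟨ split c x P r (suc h C 2) (suc h * r) ⟩
  c * (P + suc r) + x * (P + suc r) + suc (suc h C 2 + suc h * r)
    ≤⟨ +-mono-≤ (+-monoʳ-≤ (c * (P + suc r)) (*-monoʳ-≤ x P+1+r≤c*k))
                first-pairs ⟩
  c * (P + suc r) + x * (c * k) + (c * h + suc c C 2)
    ≡⟨ merge c x P h r (suc c C 2) ⟩
  c * (P + k + x * k) + suc c C 2
    ≤⟨ +-monoˡ-≤ (suc c C 2) (*-monoʳ-≤ c grow) ⟩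
  c * (suc (x + k) C 2) + suc c C 2 ∎
  where
  open ≤-Reasoning
  k P : ℕ
  k = suc h + r
  P = k C 2
  P+1+r≤c*k : P + suc r ≤ c * k
  P+1+r≤c*k = begin
    P + suc r   ≤⟨ +-monoʳ-≤ P (s≤s (m≤n+m r h)) ⟩
    P + k       ≡⟨ trans ([1+n]C2≡n+nC2 k) (+-comm k P) ⟨
    suc k C 2   ≤⟨ [1+n]C2≤m*n c k (≤-trans (s≤s (m≤n+m k x)) m≤2c) ⟩
    c * k       ∎
  first-pairs : suc (suc h C 2 + suc h * r) ≤ c * h + suc c C 2
  first-pairs = [1+h]C2+[1+h]*r<c*h+[1+c]C2 c h r (≤-trans (s≤s (m≤n+m k x)) m≤2c)
  grow : P + k + x * k ≤ suc (x + k) C 2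
  grow = begin
    P + k + x * k                  ≡⟨ +-assoc P k (x * k) ⟩
    P + suc x * k                  ≤⟨ m≤n+m _ (suc x C 2) ⟩
    suc x C 2 + (P + suc x * k)    ≡⟨ trans (sym (+-assoc (suc x C 2) P _)) (sym ([m+n]C2≡mC2+nC2+m*n (suc x) k)) ⟩
    suc (x + k) C 2                ∎
  split : ∀ c x P r a b → suc ((c + x) * P + (c + x) * suc r + (a + b)) ≡ c * (P + suc r) + x * (P + suc r) + suc (a + b)
  split = solve-∀
  merge : ∀ c x P h r S → c * (P + suc r) + x * (c * (suc h + r)) + (c * h + S) ≡ c * (P + (suc h + r) + x * (suc h + r)) + S
  merge = solve-∀

coverSize<peak : ∀ n c x h r → 3 * c ≤ n + 2 → n ≤ 3 * c → suc (x + (suc h + r)) ≡ n →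
                 coverSize x (suc h) r < peak n c
coverSize<peak n c x h r 3c≤n+2 n≤3c n≡ with suc x ≤? c
... | yes x<c = begin-strict
  coverSize x (suc h) r                 <⟨ coverSize<peak-below x (suc h) r ⟩
  suc x * ((suc h + r) C 2) + suc (suc x) C 2
    ≡⟨ cong (λ q → suc x * (q C 2) + suc (suc x) C 2) (trans (sym (m+n∸m≡n (suc x) (suc h + r))) (cong (_∸ suc x) n≡)) ⟩
  peak n (suc x)                        ≤⟨ peak-mono n (suc x) (c ∸ suc x) (subst (λ j → 3 * j ≤ n + 2) (sym (m+[n∸m]≡n x<c)) 3c≤n+2) ⟩
  peak n (suc x + (c ∸ suc x))          ≡⟨ cong (peak n) (m+[n∸m]≡n x<c) ⟩
  peak n c                              ∎
  where open ≤-Reasoning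
... | no x≮c = subst (coverSize x (suc h) r <_) (cong (λ q → c * (q C 2) + suc c C 2) m≡n∸c)
                 (subst (λ x → coverSize x (suc h) r < c * (m C 2) + suc c C 2) c+x'≡x
                   (coverSize<peak-beyond c x' h r m≤2c))
  where
  x' m : ℕ
  x' = x ∸ c
  c+x'≡x : c + x' ≡ x
  c+x'≡x = m+[n∸m]≡n (≮⇒≥ x≮c)
  m = suc (x' + (suc h + r))
  c+m≡n : c + m ≡ n
  c+m≡n = trans (+-suc c _) (trans (cong suc (trans (sym (+-assoc c x' _)) (cong (_+ (suc h + r)) c+x'≡x))) n≡)
  m≡n∸c : m ≡ n ∸ c
  m≡n∸c = trans (sym (m+n∸m≡n c m)) (cong (_∸ c) c+m≡n)
  m≤2c : m ≤ 2 * c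
  m≤2c = +-cancelˡ-≤ c _ _ (subst₂ _≤_ (sym c+m≡n) (identity c) n≤3c)
    where
    identity : ∀ c → 3 * c ≡ c + 2 * c
    identity = solve-∀

<⇒≤1+[∸2] : ∀ {k m} → k < m → k ≤ suc (m ∸ 2)
<⇒≤1+[∸2] {m = suc zero}    (s≤s z≤n) = z≤n
<⇒≤1+[∸2] {m = suc (suc m)} k<m       = ≤-pred k<m

-- 3-subsets

elements : ∀ {n} → Subset n → List (Fin n)
elements []          = []
elements (true ∷ p)  = fzero ∷ map fsuc (elements p)
elements (false ∷ p) = map fsuc (elements p)

length-elements : ∀ {n} (p : Subset n) → length (elements p) ≡ ∣ p ∣
length-elements []          = refl
length-elements (true ∷ p)  = cong suc (trans (length-map fsuc (elements p)) (length-elements p))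
length-elements (false ∷ p) = trans (length-map fsuc (elements p)) (length-elements p)

∈-elements⁺ : ∀ {n} (p : Subset n) {z} → z ∈ₛ p → z ∈ elements p
∈-elements⁺ (true ∷ p)  Vec.here       = here refl
∈-elements⁺ (true ∷ p)  (Vec.there z∈p) = there (∈-map⁺ fsuc (∈-elements⁺ p z∈p))
∈-elements⁺ (false ∷ p) (Vec.there z∈p) = ∈-map⁺ fsuc (∈-elements⁺ p z∈p)

∈-elements⁻ : ∀ {n} (p : Subset n) {z} → z ∈ elements p → z ∈ₛ p
∈-elements⁻ (true ∷ p) (here refl) = Vec.here
∈-elements⁻ (true ∷ p) (there z∈) with ∈-map⁻ fsuc z∈
... | _ , y∈ , refl = Vec.there (∈-elements⁻ p y∈)
∈-elements⁻ (false ∷ p) z∈ with ∈-map⁻ fsuc z∈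
... | _ , y∈ , refl = Vec.there (∈-elements⁻ p y∈)

elements-increasing : ∀ {n} (p : Subset n) → Linked Data.Fin._<_ (elements p)
elements-increasing []          = Linked.[]
elements-increasing (true ∷ p)  = zero∷ (elements p) (map⁺ (Linked.map s≤s (elements-increasing p)))
  where
  zero∷ : ∀ {n} (xs : List (Fin n)) → Linked Data.Fin._<_ (map fsuc xs) → Linked Data.Fin._<_ (fzero ∷ map fsuc xs)
  zero∷ []       _  = [-]
  zero∷ (x ∷ xs) l = s≤s z≤n ∷ₗ l
elements-increasing (false ∷ p) = map⁺ (Linked.map s≤s (elements-increasing p))

record Sorted {n} (v : Triple n) : Set where
  field
    a b d     : Fin n
    a<b       : toℕ a < toℕ b
    b<d       : toℕ b < toℕ d
    elements≡ : elements (set v) ≡ a ∷ b ∷ d ∷ []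

  ∈-set⁻ : ∀ {z} → z ∈ₛ set v → z ≡ a ⊎ z ≡ b ⊎ z ≡ d
  ∈-set⁻ z∈v with subst (_ ∈_) elements≡ (∈-elements⁺ (set v) z∈v)
  ... | here z≡a               = inj₁ z≡a
  ... | there (here z≡b)       = inj₂ (inj₁ z≡b)
  ... | there (there (here z≡d)) = inj₂ (inj₂ z≡d)

  ∈-set⁺ : ∀ {z} → z ≡ a ⊎ z ≡ b ⊎ z ≡ d → z ∈ₛ set v
  ∈-set⁺ z∈abd = ∈-elements⁻ (set v) (subst (_ ∈_) (sym elements≡) (as-list z∈abd))
    where
    as-list : ∀ {z} → z ≡ a ⊎ z ≡ b ⊎ z ≡ d → z ∈ a ∷ b ∷ d ∷ []
    as-list (inj₁ z≡a)        = here z≡a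
    as-list (inj₂ (inj₁ z≡b)) = there (here z≡b)
    as-list (inj₂ (inj₂ z≡d)) = there (there (here z≡d))

sorted : ∀ {n} (v : Triple n) → Sorted v
sorted v = from-list (elements (set v)) refl (trans (length-elements (set v)) (card v)) (elements-increasing (set v))
  where
  from-list : ∀ xs → elements (set v) ≡ xs → length xs ≡ 3 → Linked Data.Fin._<_ xs → Sorted v
  from-list (a ∷ b ∷ d ∷ []) eq refl (a<b ∷ₗ b<d ∷ₗ [-]) = record { a = a ; b = b ; d = d ; a<b = a<b ; b<d = b<d ; elements≡ = eq }

two-outside-impossible : ∀ {n} {u w : Triple n} {x y} → SymDiffIs (set u) (set w) x y →
                         ∀ {e₁ e₂} → e₁ ≢ e₂ → e₁ ∈ₛ set u → e₂ ∈ₛ set u → e₁ ∉ₛ set w → e₂ ∉ₛ set w → ⊥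
two-outside-impossible {u = u} {w} {x} {y} sd {e₁} {e₂} e₁≢e₂ e₁∈u e₂∈u e₁∉w e₂∉w =
  <-irrefl refl (begin-strict
    3                        ≡⟨ card w ⟨
    ∣ set w ∣                ≤⟨ p⊆q⇒∣p∣≤∣q∣ w⊆u-e₁-e₂ ⟩
    ∣ set u - e₁ - e₂ ∣      <⟨ x∈p⇒∣p-x∣<∣p∣ (x∈p∧x≢y⇒x∈p-y e₂∈u (e₁≢e₂ ∘ sym)) ⟩
    ∣ set u - e₁ ∣           <⟨ x∈p⇒∣p-x∣<∣p∣ e₁∈u ⟩
    ∣ set u ∣                ≡⟨ card u ⟩
    3                        ∎)
  where
  open ≤-Reasoning
  e₁-out : e₁ ≡ x ⊎ e₁ ≡ y
  e₁-out = proj₁ (sd e₁) (inj₁ (e₁∈u , e₁∉w))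
  e₂-out : e₂ ≡ x ⊎ e₂ ≡ y
  e₂-out = proj₁ (sd e₂) (inj₁ (e₂∈u , e₂∉w))
  -- e₁ and e₂ are distinct elements of {x , y}, so they exhaust it
  xy⇒e₁e₂ : ∀ {z} → z ≡ x ⊎ z ≡ y → z ≡ e₁ ⊎ z ≡ e₂
  xy⇒e₁e₂ z∈xy with e₁-out | e₂-out | z∈xy
  ... | inj₁ refl | inj₁ refl | _         = ⊥-elim (e₁≢e₂ refl)
  ... | inj₂ refl | inj₂ refl | _         = ⊥-elim (e₁≢e₂ refl)
  ... | inj₁ refl | inj₂ refl | inj₁ refl = inj₁ refl
  ... | inj₁ refl | inj₂ refl | inj₂ refl = inj₂ refl
  ... | inj₂ refl | inj₁ refl | inj₁ refl = inj₂ refl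
  ... | inj₂ refl | inj₁ refl | inj₂ refl = inj₁ refl
  w⊆u-e₁-e₂ : set w ⊆ set u - e₁ - e₂
  w⊆u-e₁-e₂ {z} z∈w = x∈p∧x≢y⇒x∈p-y (x∈p∧x≢y⇒x∈p-y z∈u (λ { refl → e₁∉w z∈w })) (λ { refl → e₂∉w z∈w })
    where
    z∈u : z ∈ₛ set u
    z∈u with z ∈? set u
    ... | yes z∈u = z∈u
    ... | no  z∉u with xy⇒e₁e₂ (proj₁ (sd z) (inj₂ (z∈w , z∉u)))
    ...   | inj₁ refl = ⊥-elim (e₁∉w z∈w)
    ...   | inj₂ refl = ⊥-elim (e₂∉w z∈w)

SharedPair : ∀ {n} → Triple n → Triple n → Set
SharedPair {n} u w = ∃[ p ] ∃[ q ] (toℕ p < toℕ q × p ∈ₛ set u × q ∈ₛ set u × p ∈ₛ set w × q ∈ₛ set w)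

module _ {n} {u w : Triple n} {x y} (sd : SymDiffIs (set u) (set w) x y) where
  open Sorted (sorted u)

  private
    a∈u : a ∈ₛ set u
    a∈u = ∈-set⁺ (inj₁ refl)
    b∈u : b ∈ₛ set u
    b∈u = ∈-set⁺ (inj₂ (inj₁ refl))
    d∈u : d ∈ₛ set u
    d∈u = ∈-set⁺ (inj₂ (inj₂ refl))
    ≢-from-< : ∀ {p q : Fin n} → toℕ p < toℕ q → p ≢ q
    ≢-from-< p<q refl = <-irrefl refl p<q

  symDiff⇒sharedPair : SharedPair u w
  symDiff⇒sharedPair with a ∈? set w | b ∈? set w | d ∈? set w
  ... | yes a∈w | yes b∈w | _       = a , b , a<b , a∈u , b∈u , a∈w , b∈w
  ... | yes a∈w | no _    | yes d∈w = a , d , <-trans a<b b<d , a∈u , d∈u , a∈w , d∈w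
  ... | no _    | yes b∈w | yes d∈w = b , d , b<d , b∈u , d∈u , b∈w , d∈w
  ... | yes _   | no b∉w  | no d∉w  = ⊥-elim (two-outside-impossible {u = u} {w} sd (≢-from-< {b} {d} b<d) b∈u d∈u b∉w d∉w)
  ... | no a∉w  | yes _   | no d∉w  = ⊥-elim (two-outside-impossible {u = u} {w} sd (≢-from-< {a} {d} (<-trans a<b b<d)) a∈u d∈u a∉w d∉w)
  ... | no a∉w  | no b∉w  | _       = ⊥-elim (two-outside-impossible {u = u} {w} sd (≢-from-< {a} {b} a<b) a∈u b∈u a∉w b∉w)

fin? : ∀ n → ℕ → Maybe (Fin n)
fin? n i with i <? n
... | yes i<n = just (fromℕ< i<n)
... | no  _   = nothing

fin?-toℕ : ∀ {n} (i : Fin n) → fin? n (toℕ i) ≡ just i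
fin?-toℕ {n} i with toℕ i <? n
... | yes i<n = cong just (fromℕ<-toℕ i i<n)
... | no  i≮n = ⊥-elim (i≮n (toℕ<n i))

toTriple : ∀ {n} → Subset n → Maybe (Triple n)
toTriple p with ∣ p ∣ ≟ 3
... | yes |p|≡3 = just (triple p |p|≡3)
... | no  _     = nothing

toTriple-set : ∀ {n} (v : Triple n) → toTriple (set v) ≡ just v
toTriple-set (triple p |p|≡3) with ∣ p ∣ ≟ 3
... | yes e   = cong (just ∘ triple p) (≡-irrelevant e |p|≡3)
... | no  |p|≢3 = ⊥-elim (|p|≢3 |p|≡3)

positions : ∀ {n} → Triple n → ℕ × ℕ × ℕ
positions v = toℕ a , toℕ b , toℕ d
  where open Sorted (sorted v)

fromPositions : ∀ {n} → ℕ × ℕ × ℕ → Maybe (Triple n)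
fromPositions {n} (i , j , k) =
  fin? n i >>= λ a → fin? n j >>= λ b → fin? n k >>= λ d → toTriple (⁅ a ⁆ ∪ ⁅ b ⁆ ∪ ⁅ d ⁆)

fromPositions-toℕ : ∀ {n} (a b d : Fin n) → fromPositions (toℕ a , toℕ b , toℕ d) ≡ toTriple (⁅ a ⁆ ∪ ⁅ b ⁆ ∪ ⁅ d ⁆)
fromPositions-toℕ a b d rewrite fin?-toℕ a | fin?-toℕ b | fin?-toℕ d = refl

fromPositions-positions : ∀ {n} (v : Triple n) → fromPositions (positions v) ≡ just v
fromPositions-positions v =
  trans (fromPositions-toℕ a b d) (trans (cong toTriple (⊆-antisym abd⊆v v⊆abd)) (toTriple-set v))
  where
  open Sorted (sorted v)
  abd⊆v : ⁅ a ⁆ ∪ ⁅ b ⁆ ∪ ⁅ d ⁆ ⊆ set v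
  abd⊆v z∈ with x∈p∪q⁻ ⁅ a ⁆ _ z∈
  ... | inj₁ z∈a = ∈-set⁺ (inj₁ (x∈⁅y⁆⇒x≡y a z∈a))
  ... | inj₂ z∈bd with x∈p∪q⁻ ⁅ b ⁆ _ z∈bd
  ...   | inj₁ z∈b = ∈-set⁺ (inj₂ (inj₁ (x∈⁅y⁆⇒x≡y b z∈b)))
  ...   | inj₂ z∈d = ∈-set⁺ (inj₂ (inj₂ (x∈⁅y⁆⇒x≡y d z∈d)))
  v⊆abd : set v ⊆ ⁅ a ⁆ ∪ ⁅ b ⁆ ∪ ⁅ d ⁆
  v⊆abd z∈ with ∈-set⁻ z∈
  ... | inj₁ refl        = x∈p∪q⁺ (inj₁ (x∈⁅x⁆ a))
  ... | inj₂ (inj₁ refl) = x∈p∪q⁺ (inj₂ (x∈p∪q⁺ (inj₁ (x∈⁅x⁆ b))))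
  ... | inj₂ (inj₂ refl) = x∈p∪q⁺ (inj₂ (x∈p∪q⁺ (inj₂ (x∈⁅x⁆ d))))

module _ {n : ℕ} (v : Triple n) where
  open Sorted (sorted v)

  lexLo : ℕ
  lexLo = rank n (toℕ a) (toℕ b)

  lexHi : ℕ
  lexHi = rank n (toℕ b) (toℕ d)

  private
    ab≤ad : lexLo ≤ rank n (toℕ a) (toℕ d)
    ab≤ad = +-monoʳ-≤ (toℕ a * n) (<⇒≤ b<d)
    ad≤bd : rank n (toℕ a) (toℕ d) ≤ lexHi
    ad≤bd = <⇒≤ (rank-< (toℕ d) (toℕ d) a<b (toℕ<n d))

  lexLo≤lexHi : lexLo ≤ lexHi
  lexLo≤lexHi = ≤-trans ab≤ad ad≤bd

  alive⇒LexAlive : ∀ {t} → lexLo ≤ t × t ≤ lexHi → LexAlive n t (positions v)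
  alive⇒LexAlive alive = (a<b , b<d , toℕ<n d) , alive

  lexHi<n*n : lexHi < n * n
  lexHi<n*n = subst (lexHi <_) (+-identityʳ (n * n)) (rank-< (toℕ d) 0 (toℕ<n b) (toℕ<n d))

  pair-between : ∀ {p q} → p ∈ₛ set v → q ∈ₛ set v → toℕ p < toℕ q →
                 lexLo ≤ rank n (toℕ p) (toℕ q) × rank n (toℕ p) (toℕ q) ≤ lexHi
  pair-between p∈v q∈v p<q with ∈-set⁻ p∈v | ∈-set⁻ q∈v
  ... | inj₁ refl        | inj₂ (inj₁ refl) = ≤-refl , lexLo≤lexHi
  ... | inj₁ refl        | inj₂ (inj₂ refl) = ab≤ad , ad≤bd
  ... | inj₂ (inj₁ refl) | inj₂ (inj₂ refl) = lexLo≤lexHi , ≤-refl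
  ... | inj₁ refl        | inj₁ refl        = ⊥-elim (<-irrefl refl p<q)
  ... | inj₂ (inj₁ refl) | inj₂ (inj₁ refl) = ⊥-elim (<-irrefl refl p<q)
  ... | inj₂ (inj₂ refl) | inj₂ (inj₂ refl) = ⊥-elim (<-irrefl refl p<q)
  ... | inj₂ (inj₁ refl) | inj₁ refl        = ⊥-elim (<-asym p<q a<b)
  ... | inj₂ (inj₂ refl) | inj₁ refl        = ⊥-elim (<-asym p<q (<-trans a<b b<d))
  ... | inj₂ (inj₂ refl) | inj₂ (inj₁ refl) = ⊥-elim (<-asym p<q b<d)

lexIntervals-overlap : ∀ {n} {G : Graph (Fin n)} u w → Adj (F3 G) u w → lexLo u ≤ lexHi w × lexLo w ≤ lexHi u
lexIntervals-overlap u w (_ , _ , _ , sd) = through (symDiff⇒sharedPair {u = u} {w} sd)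
  where
  through : SharedPair u w → lexLo u ≤ lexHi w × lexLo w ≤ lexHi u
  through (p , q , p<q , p∈u , q∈u , p∈w , q∈w) =
    ≤-trans (proj₁ (pair-between u p∈u q∈u p<q)) (proj₂ (pair-between w p∈w q∈w p<q)) ,
    ≤-trans (proj₁ (pair-between w p∈w q∈w p<q)) (proj₂ (pair-between u p∈u q∈u p<q))

TwLe-F3 : ∀ n .{{_ : NonZero n}} c → 3 * c ≤ n + 2 → n ≤ 3 * c → (G : Graph (Fin n)) → TwLe (F3 G) (peak n c ∸ 2)
TwLe-F3 n c 3c≤n+2 n≤3c G =
  TwLe-intervals (F3 G) (n * n) lexLo lexHi lexLo≤lexHi (λ v → <⇒≤ (lexHi<n*n v)) lexIntervals-overlap (peak n c ∸ 2)
    λ t _ → AtMost-retract positions fromPositions (λ v alive → alive⇒LexAlive v alive , fromPositions-positions v)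
              (AtMost-lexAlive n t λ x h r n≡ → <⇒≤1+[∸2] (coverSize<peak n c x h r 3c≤n+2 n≤3c n≡))

3*ceil3≤n+2 : ∀ n → 3 * ceil3 n ≤ n + 2
3*ceil3≤n+2 n = subst (_≤ n + 2) (*-comm (ceil3 n) 3) (m/n*n≤m (n + 2) 3)

n≤3*ceil3 : ∀ n → n ≤ 3 * ceil3 n
n≤3*ceil3 n = +-cancelʳ-≤ 2 n (3 * ceil3 n) (begin
  n + 2                         ≡⟨ m≡m%n+[m/n]*n (n + 2) 3 ⟩
  (n + 2) % 3 + ceil3 n * 3     ≤⟨ +-monoˡ-≤ _ (≤-pred (m%n<n (n + 2) 3)) ⟩
  2 + ceil3 n * 3               ≡⟨ +-comm 2 _ ⟩
  ceil3 n * 3 + 2               ≡⟨ cong (_+ 2) (*-comm (ceil3 n) 3) ⟩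
  3 * ceil3 n + 2               ∎)
  where open ≤-Reasoning

[c*[c+1]]/2≡[1+c]C2 : ∀ c → (c * (c + 1)) / 2 ≡ suc c C 2
[c*[c+1]]/2≡[1+c]C2 c = trans (cong (_/ 2) c*[c+1]≡) (m*n/n≡m (suc c C 2) 2)
  where
  c*[c+1]≡ : c * (c + 1) ≡ (suc c C 2) * 2
  c*[c+1]≡ = begin
    c * (c + 1)       ≡⟨ cong (c *_) (+-comm c 1) ⟩
    c * suc c         ≡⟨ *-comm c (suc c) ⟩
    suc c * c         ≡⟨ 2*[1+n]C2≡[1+n]*n c ⟨
    2 * (suc c C 2)   ≡⟨ *-comm 2 (suc c C 2) ⟩
    (suc c C 2) * 2     ∎
    where open ≡-Reasoning

twBound≡peak∸2 : ∀ n → twBound n ≡ peak n (ceil3 n) ∸ 2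
twBound≡peak∸2 n = cong (λ q → ceil3 n * ((n ∸ ceil3 n) C 2) + q ∸ 2) ([c*[c+1]]/2≡[1+c]C2 (ceil3 n))

mainTheorem14 : (n : ℕ) → 4 ≤ n → TwLe (F3 (K n)) (twBound n)
mainTheorem14 n@(suc _) _ =
  subst (TwLe (F3 (K n))) (sym (twBound≡peak∸2 n))
    (TwLe-F3 n (ceil3 n) (3*ceil3≤n+2 n) (n≤3*ceil3 n) (K n))
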